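{- Let $n\ge 4$ and let $\emptyset\neq J\subseteq[1,n-1]$ with $\mu=\max J$. Let $1\le a<b\le\mu$ and $K=[1,a]\cup[b,\mu]$. Then $\overleftarrow{\delta}(J)\le_L\overleftarrow{\delta}(J\cap K)$.
   Context: Intervals are in $\mathbb Z$. For $J\subseteq\{1,\dots,n-1\}$, write $J\cup\{0\}=\{j_1>\dots>j_p>j_{p+1}=0\}$ and set $\overleftarrow{\delta}(J)=(j_1-j_2,\dots,j_p-j_{p+1})$, a word in the alphabet $\{1,\dots,n-1\}$. $\le_L$ is the lexicographic (left to right) order on the set of all finite words (including the empty word) in the alphabet $\{1,\dots,n-1\}$. -}

module Defs where

open import Data.Nat using (ℕ; zero; suc; _∸_; _<_; _≤_; _≤ᵇ_)
open import Data.Bool using (Bool; true; false; if_then_else_; _∧_; _∨_)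
open import Data.List using (List; []; _∷_; _++_; [_])
open import Relation.Binary.PropositionalEquality using (_≡_)
open import Data.List.Relation.Binary.Lex.Strict using (Lex-≤)

elemsDesc : (ℕ → Bool) → ℕ → List ℕ
elemsDesc J zero    = []
elemsDesc J (suc m) = if J (suc m) then suc m ∷ elemsDesc J m else elemsDesc J m

diffs : List ℕ → List ℕ
diffs []           = []
diffs (x ∷ [])     = []
diffs (x ∷ y ∷ xs) = (x ∸ y) ∷ diffs (y ∷ xs)

-- δ⃖(J) for J ⊆ [1, n-1]:  J ∪ {0} = {j₁ > … > j_p > j_{p+1} = 0},
-- δ⃖(J) = (j₁ - j₂, …, j_p - j_{p+1}).
δ← : ℕ → (ℕ → Bool) → List ℕ
δ← n J = diffs (elemsDesc J (n ∸ 1) ++ [ 0 ])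

_≤L_ : List ℕ → List ℕ → Set
_≤L_ = Lex-≤ _≡_ _<_

_∩_ : (ℕ → Bool) → (ℕ → Bool) → (ℕ → Bool)
(J ∩ K) i = J i ∧ K i

interval : ℕ → ℕ → (ℕ → Bool)
interval x y i = (x ≤ᵇ i) ∧ (i ≤ᵇ y)

Kset : ℕ → ℕ → ℕ → (ℕ → Bool)
Kset a b μ i = interval 1 a i ∨ interval b μ i

{-# OPTIONS --safe #-}
module Submission where

-- Intersecting J with a set K that contains μ = max J keeps the top element μ,
-- so both words start by descending through the same elements of J. At the
-- first element j of J missing from K, δ⃖(J) has the letter x − j while
-- δ⃖(J ∩ K) has x − y for the next surviving element y < j (or y = 0), which
-- is strictly larger; before that point the two words agree.

open import Defs
open import Data.Nat using (ℕ; zero; suc; _≤_; _<_; _≤′_; _∸_; s≤s; z≤n)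
open import Data.Nat.Base using (≤′-refl; ≤′-step)
open import Data.Nat.Properties
  using (≤-refl; <⇒≤; <⇒≱; m≤n⇒m≤1+n; n<1+n; <-trans; ∸-monoʳ-<; ≤⇒≤ᵇ; ≤⇒≤′; ≤′⇒≤)
open import Data.Bool using (Bool; true; false; _∧_; _∨_)
open import Data.Bool.Properties using (T-≡; T-∧; ∨-zeroʳ)
open import Data.Product using (_×_; _,_; proj₂)
open import Data.Unit using (tt)
open import Data.List using (List; []; _∷_; _++_; [_])
open import Data.List.Relation.Binary.Lex.Strict using (base; this; next)
open import Function.Bundles using (Equivalence)
open import Relation.Binary.PropositionalEquality using (_≡_; refl; sym; trans; cong; subst₂)
open import Relation.Nullary using (contradiction)

data HeadAtMost (k : ℕ) : List ℕ → Set where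
  head≤ : ∀ {y ys} → y ≤ k → HeadAtMost k (y ∷ ys)

elemsDesc-head≤ : ∀ J k → HeadAtMost k (elemsDesc J k ++ [ 0 ])
elemsDesc-head≤ J zero = head≤ z≤n
elemsDesc-head≤ J (suc k) with J (suc k)
... | true  = head≤ ≤-refl
... | false with elemsDesc J k ++ [ 0 ] | elemsDesc-head≤ J k
...   | _ | head≤ y≤k = head≤ (m≤n⇒m≤1+n y≤k)

elemsDesc-above-max : ∀ J {μ m} → (∀ i → J i ≡ true → i ≤ μ) → μ ≤′ m
  → elemsDesc J m ≡ elemsDesc J μ
elemsDesc-above-max J bound ≤′-refl = refl
elemsDesc-above-max J bound (≤′-step {k} μ≤′k) with J (suc k) in Jk
... | true  = contradiction (bound (suc k) Jk) (<⇒≱ (s≤s (≤′⇒≤ μ≤′k)))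
... | false = elemsDesc-above-max J bound μ≤′k

∩-⊆ˡ : ∀ (J K : ℕ → Bool) {i} → (J ∩ K) i ≡ true → J i ≡ true
∩-⊆ˡ J K {i} J∩Ki with J i
... | true  = refl
... | false = J∩Ki

diffs-cons-≤L-∩ : ∀ J K m x → m < x
  → diffs (x ∷ elemsDesc J m ++ [ 0 ]) ≤L diffs (x ∷ elemsDesc (J ∩ K) m ++ [ 0 ])
diffs-cons-≤L-∩ J K zero    x _   = next refl (base tt)
diffs-cons-≤L-∩ J K (suc k) x k<x with J (suc k) | K (suc k)
... | true  | true  = next refl (diffs-cons-≤L-∩ J K k (suc k) ≤-refl)
... | true  | false with elemsDesc (J ∩ K) k ++ [ 0 ] | elemsDesc-head≤ (J ∩ K) k
...   | _ | head≤ y≤k = this (∸-monoʳ-< (s≤s y≤k) (<⇒≤ k<x))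
diffs-cons-≤L-∩ J K (suc k) x k<x | false | _ = diffs-cons-≤L-∩ J K k x (<-trans (n<1+n k) k<x)

δ←-≤L-∩ : ∀ n J K μ → J μ ≡ true → K μ ≡ true → (∀ i → J i ≡ true → i ≤ μ)
  → μ ≤ n ∸ 1 → δ← n J ≤L δ← n (J ∩ K)
δ←-≤L-∩ n J K μ Jμ Kμ bound μ≤ =
  subst₂ (λ xs ys → diffs (xs ++ [ 0 ]) ≤L diffs (ys ++ [ 0 ]))
    (sym (elemsDesc-above-max J bound (≤⇒≤′ μ≤)))
    (sym (elemsDesc-above-max (J ∩ K) (λ i e → bound i (∩-⊆ˡ J K e)) (≤⇒≤′ μ≤)))
    (from-max μ Jμ Kμ)
  where
  from-max : ∀ μ → J μ ≡ true → K μ ≡ true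
    → diffs (elemsDesc J μ ++ [ 0 ]) ≤L diffs (elemsDesc (J ∩ K) μ ++ [ 0 ])
  from-max zero    _  _  = base tt
  from-max (suc k) Jμ Kμ rewrite Jμ | Kμ = diffs-cons-≤L-∩ J K k (suc k) ≤-refl

interval-∋ : ∀ {x y i} → x ≤ i → i ≤ y → interval x y i ≡ true
interval-∋ x≤i i≤y = Equivalence.to T-≡ (Equivalence.from T-∧ (≤⇒≤ᵇ x≤i , ≤⇒≤ᵇ i≤y))

Kset-∋-max : ∀ a b μ → b ≤ μ → Kset a b μ μ ≡ true
Kset-∋-max a b μ b≤μ =
  trans (cong (interval 1 a μ ∨_) (interval-∋ b≤μ ≤-refl)) (∨-zeroʳ (interval 1 a μ))

lemma4p17 : (n : ℕ) → 4 ≤ n → (J : ℕ → Bool)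
    → (∀ i → J i ≡ true → 1 ≤ i × i ≤ n ∸ 1)
    → (μ : ℕ) → J μ ≡ true → (∀ i → J i ≡ true → i ≤ μ)
    → (a b : ℕ) → 1 ≤ a → a < b → b ≤ μ
    → δ← n J ≤L δ← n (J ∩ Kset a b μ)
lemma4p17 n _ J range μ Jμ bound a b _ _ b≤μ =
  δ←-≤L-∩ n J (Kset a b μ) μ Jμ (Kset-∋-max a b μ b≤μ) bound (proj₂ (range μ Jμ))
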